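{- Let $G$ be a regular bi-directed graph of degree $d$ with $P$ vertices. Then every one-way communication graph for universal broadcast on $G$ has time $\tau\ge \frac{2(P-1)}{d}$.
   Context: A bi-directed graph is one in which whenever $(u,v)$ is a directed edge so is $(v,u)$; regular of degree $d$ means each vertex has exactly $d$ neighbours. A task graph on $G$ is a finite sequence $(e_i)$ of directed edges of $G$ labeled by positive integer times $t(e_i)$ such that (i) $t(e_i)<t(e_j)$ implies $e_i<e_j$ or $e_i,e_j$ incomparable, and (ii) $t(e_i)=t(e_j)$ implies $i=j$ or $e_i,e_j$ incomparable, where $e_i<e_j$ means there is a directed path in the task graph beginning with $e_i$ and ending with $e_j$. Its time is its maximum label. A one-way communication graph is a collection of task graphs such that no two edge occurrences in the collection that join the same two vertices (in either direction) carry the same label; its time is the maximum time of its task graphs. A broadcast from $v$ is a task graph containing a directed path from $v$ to every other vertex; a one-way communication graph for universal broadcast consists of a broadcast from each vertex. -}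

module Defs where

open import Data.Nat using (ℕ; _≤_; _<_; _⊔_)
open import Data.Bool using (Bool; true; false)
open import Data.Fin using (Fin; toℕ)
open import Data.List using (List; length; lookup; map; foldr; filterᵇ; allFin)
open import Data.Product using (_×_; Σ; ∃; ∃-syntax; _,_)
open import Data.Sum using (_⊎_)
open import Relation.Binary.PropositionalEquality using (_≡_; _≢_)
open import Relation.Nullary using (¬_)

record BiGraph (P : ℕ) : Set where
  field
    adj       : Fin P → Fin P → Bool
    bidirected : ∀ u v → adj u v ≡ true → adj v u ≡ true
    loopless  : ∀ v → adj v v ≡ false

open BiGraph public

degree : ∀ {P} → BiGraph P → Fin P → ℕ
degree {P} G v = length (filterᵇ (adj G v) (allFin P))

Regular : ∀ {P} → BiGraph P → ℕ → Set
Regular G d = ∀ v → degree G v ≡ d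

record Occ (P : ℕ) : Set where
  constructor occ
  field
    src  : Fin P
    tgt  : Fin P
    time : ℕ

open Occ public

Seq : ℕ → Set
Seq P = List (Occ P)

data _⊢_≺_ {P : ℕ} (L : Seq P) : Fin (length L) → Fin (length L) → Set where
  link : ∀ {i j} → tgt (lookup L i) ≡ src (lookup L j) → L ⊢ i ≺ j
  more : ∀ {i j k} → L ⊢ i ≺ j → tgt (lookup L j) ≡ src (lookup L k) → L ⊢ i ≺ k

Incomparable : ∀ {P} (L : Seq P) → Fin (length L) → Fin (length L) → Set
Incomparable L i j = ¬ (L ⊢ i ≺ j) × ¬ (L ⊢ j ≺ i)

record IsTaskGraph {P : ℕ} (G : BiGraph P) (L : Seq P) : Set where
  field
    edges    : ∀ i → adj G (src (lookup L i)) (tgt (lookup L i)) ≡ true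
    positive : ∀ i → 1 ≤ time (lookup L i)
    cond-i   : ∀ i j → time (lookup L i) < time (lookup L j) →
               (L ⊢ i ≺ j) ⊎ Incomparable L i j
    cond-ii  : ∀ i j → time (lookup L i) ≡ time (lookup L j) →
               (i ≡ j) ⊎ Incomparable L i j

taskTime : ∀ {P} → Seq P → ℕ
taskTime L = foldr _⊔_ 0 (map time L)

-- a directed path in the task graph from vertex v to vertex w
-- (a single occurrence from v to w, or a chain e_i < ... < e_j)
PathFromTo : ∀ {P} → Seq P → Fin P → Fin P → Set
PathFromTo L v w = ∃[ i ] ∃[ j ] (src (lookup L i) ≡ v × tgt (lookup L j) ≡ w ×
                                  ((i ≡ j) ⊎ (L ⊢ i ≺ j)))

IsBroadcast : ∀ {P} → BiGraph P → Fin P → Seq P → Set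
IsBroadcast G v L = IsTaskGraph G L × (∀ w → w ≢ v → PathFromTo L v w)

SameEnds : ∀ {P} → Occ P → Occ P → Set
SameEnds a b = (src a ≡ src b × tgt a ≡ tgt b) ⊎ (src a ≡ tgt b × tgt a ≡ src b)

-- a one-way communication graph for universal broadcast on G:
-- a broadcast B v from each vertex v, such that no two distinct edge occurrences
-- in the collection joining the same two vertices carry the same label.
record IsUniversalBroadcastOWCG {P : ℕ} (G : BiGraph P) (B : Fin P → Seq P) : Set where
  field
    broadcast : ∀ v → IsBroadcast G v (B v)
    one-way   : ∀ u v (i : Fin (length (B u))) (j : Fin (length (B v))) →
                ¬ (u ≡ v × toℕ i ≡ toℕ j) →
                SameEnds (lookup (B u) i) (lookup (B v) j) →
                time (lookup (B u) i) ≢ time (lookup (B v) j)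

commTime : ∀ {P} → (Fin P → Seq P) → ℕ
commTime {P} B = foldr _⊔_ 0 (map (λ v → taskTime (B v)) (allFin P))

-- Every broadcast from v ends, for each w ≠ v, with an occurrence entering w; these
-- P(P-1) occurrences are distinct. Traversing each of them in both directions gives
-- 2P(P-1) pairs (directed edge, label), and the one-way condition makes these pairs
-- distinct. There are only Pd directed edges and τ positive labels, so
-- 2P(P-1) ≤ Pdτ.
module Submission where

open import Defs
open import Data.Nat using (ℕ; zero; suc; _≤_; _*_; _∸_; _⊔_; z≤n) renaming (_≟_ to _≟ℕ_)
open import Data.Nat.Properties using (≤-trans; m≤m⊔n; m≤n⊔m; *-cancelˡ-≤)
open import Data.Bool using (true; T)
open import Data.Bool.Properties using (T?)
open import Data.Fin using (Fin; toℕ; fromℕ<; cast; punchIn; _≟_)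
open import Data.Fin.Patterns using (0F; 1F)
open import Data.Fin.Properties
  using (toℕ-injective; toℕ-fromℕ<; toℕ-cast; punchIn-injective; punchInᵢ≢i; injective⇒≤; *↔×)
open import Data.List using (List; length; lookup; foldr; filterᵇ; allFin)
open import Data.List.Membership.Propositional using (_∈_)
open import Data.List.Membership.Propositional.Properties using (∈-map⁺; ∈-lookup; ∈-filter⁺; ∈-allFin)
open import Data.List.Relation.Unary.Any as Any using (here; there)
open import Data.List.Relation.Unary.Any.Properties using (lookup-index)
open import Data.Product using (Σ; _×_; _,_; proj₁; proj₂; uncurry)
open import Data.Product.Function.NonDependent.Propositional using (_×-↔_)
open import Data.Sum using (inj₁; inj₂)
open import Data.Empty using (⊥-elim)
open import Function using (_∘_; Injective)
open import Function.Bundles using (_↔_; _↣_; mk↣; Injection)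
open import Function.Properties.Inverse using (↔-refl; ↔-sym; ↔-trans; ↔⇒↣)
open import Function.Properties.Injection using (↣-trans)
open import Relation.Binary.PropositionalEquality
  using (_≡_; _≢_; refl; sym; trans; cong; cong₂; subst)
open import Relation.Nullary using (yes; no)

∈⇒≤foldr-⊔ : ∀ {x : ℕ} {xs : List ℕ} → x ∈ xs → x ≤ foldr _⊔_ 0 xs
∈⇒≤foldr-⊔ (here refl)  = m≤m⊔n _ _
∈⇒≤foldr-⊔ (there x∈xs) = ≤-trans (∈⇒≤foldr-⊔ x∈xs) (m≤n⊔m _ _)

time≤commTime : ∀ {P} (B : Fin P → Seq P) u (i : Fin (length (B u))) →
                time (lookup (B u) i) ≤ commTime B
time≤commTime B u i = ≤-trans (∈⇒≤foldr-⊔ (∈-map⁺ time (∈-lookup {xs = B u} i)))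
                              (∈⇒≤foldr-⊔ (∈-map⁺ (taskTime ∘ B) (∈-allFin u)))

*³↔× : ∀ {a b c} → Fin (a * (b * c)) ↔ (Fin a × Fin b × Fin c)
*³↔× = ↔-trans *↔× (↔-refl ×-↔ *↔×)

↣⇒*³-≤ : ∀ {a b c a′ b′ c′} → (Fin a × Fin b × Fin c) ↣ (Fin a′ × Fin b′ × Fin c′) →
         a * (b * c) ≤ a′ * (b′ * c′)
↣⇒*³-≤ f = injective⇒≤ (Injection.injective (↣-trans (↔⇒↣ *³↔×) (↣-trans f (↔⇒↣ (↔-sym *³↔×)))))

cast-injective : ∀ {m n} (eq : m ≡ n) {i j : Fin m} → cast eq i ≡ cast eq j → i ≡ j
cast-injective eq {i} {j} e =
  toℕ-injective (trans (sym (toℕ-cast eq i)) (trans (cong toℕ e) (toℕ-cast eq j)))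

-- Labels are positive, so a label t ≤ τ is coded by t - 1 ∈ Fin τ.
positiveLabel : ∀ {τ} t → 1 ≤ t → t ≤ τ → Fin τ
positiveLabel (suc t) _ t<τ = fromℕ< t<τ

positiveLabel-injective : ∀ {τ} {t t′} {p : 1 ≤ t} {p′ : 1 ≤ t′} {q : t ≤ τ} {q′ : t′ ≤ τ} →
                          positiveLabel t p q ≡ positiveLabel t′ p′ q′ → t ≡ t′
positiveLabel-injective {t = suc t} {suc t′} {q = q} {q′ = q′} e =
  cong suc (trans (sym (toℕ-fromℕ< q)) (trans (cong toℕ e) (toℕ-fromℕ< q′)))

module _ {P} (G : BiGraph P) where

  neighbour∈ : ∀ {x y} → adj G x y ≡ true → y ∈ filterᵇ (adj G x) (allFin P)
  neighbour∈ {x} {y} xy = ∈-filter⁺ (T? ∘ adj G x) (∈-allFin y) (subst T (sym xy) _)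

  neighbourIndex : ∀ {x y} → adj G x y ≡ true → Fin (degree G x)
  neighbourIndex = Any.index ∘ neighbour∈

  neighbourIndex-injective : ∀ {x y y′} (xy : adj G x y ≡ true) (xy′ : adj G x y′ ≡ true) →
                             neighbourIndex xy ≡ neighbourIndex xy′ → y ≡ y′
  neighbourIndex-injective {x} xy xy′ e =
    trans (lookup-index (neighbour∈ xy))
          (trans (cong (lookup (filterᵇ (adj G x) (allFin P))) e) (sym (lookup-index (neighbour∈ xy′))))

  -- In a d-regular graph the directed edges are coded by a tail and one of d neighbour slots.
  directedEdge : ∀ {d} → Regular G d → ∀ {x y} → adj G x y ≡ true → Fin P × Fin d
  directedEdge reg {x} xy = x , cast (reg x) (neighbourIndex xy)

  directedEdge-injective : ∀ {d} (reg : Regular G d) {x y x′ y′}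
                           (xy : adj G x y ≡ true) (xy′ : adj G x′ y′ ≡ true) →
                           directedEdge reg xy ≡ directedEdge reg xy′ → (x , y) ≡ (x′ , y′)
  directedEdge-injective reg {x} xy xy′ e with cong proj₁ e
  ... | refl = cong (x ,_) (neighbourIndex-injective xy xy′ (cast-injective (reg x) (cong proj₂ e)))

  adjacent⇒≢ : ∀ {x y} → adj G x y ≡ true → x ≢ y
  adjacent⇒≢ {x} xy refl with trans (sym xy) (loopless G x)
  ... | ()

module Occurrences {P} {G : BiGraph P} {B : Fin P → Seq P} (U : IsUniversalBroadcastOWCG G B) where
  open IsUniversalBroadcastOWCG U

  Occurrence : Set
  Occurrence = Σ (Fin P) λ u → Fin (length (B u))

  occurrence : Occurrence → Occ P
  occurrence (u , i) = lookup (B u) i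

  label : Occurrence → ℕ
  label = time ∘ occurrence

  label-positive : ∀ c → 1 ≤ label c
  label-positive (u , i) = IsTaskGraph.positive (proj₁ (broadcast u)) i

  label≤commTime : ∀ c → label c ≤ commTime B
  label≤commTime (u , i) = time≤commTime B u i

  occurrence-adjacent : ∀ c → adj G (src (occurrence c)) (tgt (occurrence c)) ≡ true
  occurrence-adjacent (u , i) = IsTaskGraph.edges (proj₁ (broadcast u)) i

  traverse : Occurrence → Fin 2 → Fin P × Fin P
  traverse c 0F = src (occurrence c) , tgt (occurrence c)
  traverse c 1F = tgt (occurrence c) , src (occurrence c)

  traverse-adjacent : ∀ c b → uncurry (adj G) (traverse c b) ≡ true
  traverse-adjacent c 0F = occurrence-adjacent c
  traverse-adjacent c 1F = bidirected G _ _ (occurrence-adjacent c)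

  traverse⇒SameEnds : ∀ c c′ b b′ → traverse c b ≡ traverse c′ b′ →
                      SameEnds (occurrence c) (occurrence c′)
  traverse⇒SameEnds c c′ 0F 0F e = inj₁ (cong proj₁ e , cong proj₂ e)
  traverse⇒SameEnds c c′ 0F 1F e = inj₂ (cong proj₁ e , cong proj₂ e)
  traverse⇒SameEnds c c′ 1F 0F e = inj₂ (cong proj₂ e , cong proj₁ e)
  traverse⇒SameEnds c c′ 1F 1F e = inj₁ (cong proj₂ e , cong proj₁ e)

  traverse-injectiveʳ : ∀ c {b b′} → traverse c b ≡ traverse c b′ → b ≡ b′
  traverse-injectiveʳ c {0F} {0F} e = refl
  traverse-injectiveʳ c {0F} {1F} e = ⊥-elim (adjacent⇒≢ G (occurrence-adjacent c) (cong proj₁ e))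
  traverse-injectiveʳ c {1F} {0F} e = ⊥-elim (adjacent⇒≢ G (occurrence-adjacent c) (cong proj₂ e))
  traverse-injectiveʳ c {1F} {1F} e = refl

  occurrence-unique : ∀ c c′ → SameEnds (occurrence c) (occurrence c′) → label c ≡ label c′ → c ≡ c′
  occurrence-unique (u , i) (u′ , i′) ends t with u ≟ u′ | toℕ i ≟ℕ toℕ i′
  ... | yes refl | yes i≡i′ = cong (u ,_) (toℕ-injective i≡i′)
  ... | no u≢u′  | _        = ⊥-elim (one-way u u′ i i′ (u≢u′ ∘ proj₁) ends t)
  ... | yes refl | no i≢i′  = ⊥-elim (one-way u u′ i i′ (i≢i′ ∘ proj₂) ends t)

  traverse-label-injective : ∀ c c′ b b′ → traverse c b ≡ traverse c′ b′ → label c ≡ label c′ →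
                             (c , b) ≡ (c′ , b′)
  traverse-label-injective c c′ b b′ e t with occurrence-unique c c′ (traverse⇒SameEnds c c′ b b′ e) t
  ... | refl = cong (c ,_) (traverse-injectiveʳ c e)

  -- The last occurrence of a path from v to w enters w.
  entering : (v w : Fin P) → w ≢ v → Occurrence
  entering v w w≢v = v , proj₁ (proj₂ (proj₂ (broadcast v) w w≢v))

  tgt-entering : ∀ v w (w≢v : w ≢ v) → tgt (occurrence (entering v w w≢v)) ≡ w
  tgt-entering v w w≢v = proj₁ (proj₂ (proj₂ (proj₂ (proj₂ (broadcast v) w w≢v))))

module Counting {n d} {G : BiGraph (suc n)} (reg : Regular G d) {B : Fin (suc n) → Seq (suc n)}
                (U : IsUniversalBroadcastOWCG G B) where
  open Occurrences U

  τ : ℕ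
  τ = commTime B

  enteringPunchIn : Fin (suc n) → Fin n → Occurrence
  enteringPunchIn v k = entering v (punchIn v k) (punchInᵢ≢i v k)

  enteringPunchIn-injective : ∀ {v v′ k k′} → enteringPunchIn v k ≡ enteringPunchIn v′ k′ →
                              (v , k) ≡ (v′ , k′)
  enteringPunchIn-injective {v} {_} {k} {k′} e with cong proj₁ e
  ... | refl = cong (v ,_) (punchIn-injective v k k′
                 (trans (sym (tgt-entering v _ _)) (trans (cong (tgt ∘ occurrence) e) (tgt-entering v _ _))))

  code : Occurrence → Fin 2 → Fin (suc n) × Fin d × Fin τ
  code c b = proj₁ edge , proj₂ edge , positiveLabel (label c) (label-positive c) (label≤commTime c)
    where
      edge : Fin (suc n) × Fin d
      edge = directedEdge G reg (traverse-adjacent c b)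

  code-injective : ∀ {c c′ b b′} → code c b ≡ code c′ b′ → (c , b) ≡ (c′ , b′)
  code-injective {c} {c′} {b} {b′} e =
    traverse-label-injective c c′ b b′
      (directedEdge-injective G reg (traverse-adjacent c b) (traverse-adjacent c′ b′) (cong₂ _,_ (cong proj₁ e) (cong (proj₁ ∘ proj₂) e)))
      (positiveLabel-injective (cong (proj₂ ∘ proj₂) e))

  broadcastCode : Fin (suc n) × Fin 2 × Fin n → Fin (suc n) × Fin d × Fin τ
  broadcastCode (v , b , k) = code (enteringPunchIn v k) b

  broadcastCode-injective : Injective _≡_ _≡_ broadcastCode
  broadcastCode-injective {v , b , k} {v′ , b′ , k′} e =
    cong₂ (λ (v , k) b → v , b , k) (enteringPunchIn-injective (cong proj₁ cb)) (cong proj₂ cb)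
    where
      cb : (enteringPunchIn v k , b) ≡ (enteringPunchIn v′ k′ , b′)
      cb = code-injective e

theorem3p2 : (P d : ℕ) (G : BiGraph P) → Regular G d →
    (B : Fin P → Seq P) → IsUniversalBroadcastOWCG G B →
    2 * (P ∸ 1) ≤ d * commTime B
theorem3p2 zero    d G reg B U = z≤n
theorem3p2 (suc n) d G reg B U = *-cancelˡ-≤ (suc n) (↣⇒*³-≤ (mk↣ broadcastCode-injective))
  where open Counting reg U
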